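{- Let $M$ be a loopless rank-$4$ matroid that is hypermodular but not modular, with closure operator $X\mapsto\overline{X}$. Let $F$ and $L$ be disjoint flats of $M$ of rank $3$ and $2$ respectively, and let $A_1,\dots,A_n$ be all the rank-$3$ flats of $M$ containing $L$. Put $T_i=A_i\cap F$ for $i\in[n]$, $T_0=L$, and $\mathcal{T}=\{T_0,\dots,T_n\}$. For a flat $J$, let $(J\vee\mathcal{T})^{(3)}=\{\overline{J\cup T}: T\in\mathcal{T},\ r(J\cup T)=3\}$. Let $\mathcal{J}$ be the collection of rank-$2$ flats $J\subseteq E(M)-(F\sqcup L)$ with $|(J\vee\mathcal{T})^{(3)}|\ge2$, let $\mathcal{J}_+=\mathcal{J}\cup\mathcal{T}$, and let $\mathcal{J}^\sharp$ be the collection of rank-$3$ flats of $M$ containing some $T\in\mathcal{T}$. Suppose that $$\mathcal{J}^\sharp\supseteq\{\overline{J\cup J'}: J,J'\in\mathcal{J}_+,\ J\neq J'\}.$$ Then: (1) $\mathcal{J}^\sharp=\{\overline{J\cup J'}: J,J'\in\mathcal{J}_+,\ J\neq J'\}$; (2) every two distinct elements of $\mathcal{J}_+$ are disjoint; (3) $\mathcal{J}_+$ is a partition of $E(M)$; (4) for every rank-$2$ flat $X$ of $M$ with $X\notin\mathcal{J}_+$, the set $(X\vee\mathcal{T})^{(3)}$ has cardinality exactly $1$; (5) for every $X\in\mathcal{J}^\sharp$ and $J\in\mathcal{J}_+$, either $J\subset X$ or $J\cap X=\emptyset$.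
   Context: A pair of flats $\{A,B\}$ is modular if $r(A\cup B)+r(A\cap B)=r(A)+r(B)$; a matroid is modular if every pair of flats is modular. A rank-$4$ matroid is hypermodular if every pair of two rank-$3$ flats is a modular pair. $[n]=\{1,\dots,n\}$. -}

module Defs where

open import Data.Nat using (ℕ; _+_; _≤_)
import Data.Nat as ℕ
open import Data.Fin using (Fin)
open import Data.Fin.Subset
  using (Subset; _∪_; _∩_; ⁅_⁆; ⊥; ⊤; _∈_; _⊆_; _⊂_; ∣_∣; Nonempty)
open import Data.Vec using (tabulate)
open import Data.Product using (Σ; ∃; _×_; _,_)
open import Data.Sum using (_⊎_)
open import Relation.Nullary using (¬_; does)
open import Relation.Binary.PropositionalEquality using (_≡_; _≢_)

record Matroid (m : ℕ) : Set where
  field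
    r        : Subset m → ℕ
    r-card   : ∀ X → r X ≤ ∣ X ∣
    r-mono   : ∀ {X Y} → X ⊆ Y → r X ≤ r Y
    r-submod : ∀ X Y → r (X ∪ Y) + r (X ∩ Y) ≤ r X + r Y

module _ {m : ℕ} (M : Matroid m) where
  open Matroid M

  cl : Subset m → Subset m
  cl X = tabulate (λ e → does (r (X ∪ ⁅ e ⁆) ℕ.≟ r X))

  IsFlat : Subset m → Set
  IsFlat X = cl X ≡ X

  Loopless : Set
  Loopless = ∀ e → r ⁅ e ⁆ ≡ 1

  ModularPair : Subset m → Subset m → Set
  ModularPair A B = r (A ∪ B) + r (A ∩ B) ≡ r A + r B

  IsModular : Set
  IsModular = ∀ A B → IsFlat A → IsFlat B → ModularPair A B

  Hypermodular : Set
  Hypermodular = r ⊤ ≡ 4 ×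
    (∀ A B → IsFlat A → r A ≡ 3 → IsFlat B → r B ≡ 3 → ModularPair A B)

  module Setting (F L : Subset m) where

    𝒯 : Subset m → Set
    𝒯 T = T ≡ L ⊎ (Σ (Subset m) λ A → IsFlat A × r A ≡ 3 × L ⊆ A × T ≡ A ∩ F)

    -- |(J ∨ 𝒯)^(3)| ≥ 2, i.e. the set { cl (J ∪ T) | T ∈ 𝒯, r (J ∪ T) = 3 }
    -- has two distinct elements.
    AtLeastTwo : Subset m → Set
    AtLeastTwo J = Σ (Subset m) λ T → Σ (Subset m) λ T' →
      𝒯 T × 𝒯 T' × r (J ∪ T) ≡ 3 × r (J ∪ T') ≡ 3 ×
      cl (J ∪ T) ≢ cl (J ∪ T')

    -- |(X ∨ 𝒯)^(3)| = 1: the set is nonempty and all its elements coincide.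
    ExactlyOne : Subset m → Set
    ExactlyOne X =
      (Σ (Subset m) λ T → 𝒯 T × r (X ∪ T) ≡ 3) ×
      (∀ T T' → 𝒯 T → 𝒯 T' → r (X ∪ T) ≡ 3 → r (X ∪ T') ≡ 3 →
         cl (X ∪ T) ≡ cl (X ∪ T'))

    𝒥 : Subset m → Set
    𝒥 J = IsFlat J × r J ≡ 2 × J ∩ (F ∪ L) ≡ ⊥ × AtLeastTwo J

    𝒥₊ : Subset m → Set
    𝒥₊ J = 𝒥 J ⊎ 𝒯 J

    𝒥♯ : Subset m → Set
    𝒥♯ X = IsFlat X × r X ≡ 3 × (Σ (Subset m) λ T → 𝒯 T × T ⊆ X)

    JoinOfPair : Subset m → Set
    JoinOfPair X = Σ (Subset m) λ J → Σ (Subset m) λ J' →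
      𝒥₊ J × 𝒥₊ J' × J ≢ J' × X ≡ cl (J ∪ J')

{-# OPTIONS --safe #-}
-- Every block of 𝒥₊ is a line, and by hypothesis the join of two distinct blocks is a plane
-- through a member of 𝒯. In a rank-4 hypermodular matroid two distinct planes meet in a line, and
-- a plane is determined by a line and a point off it, or by two distinct lines; each part follows
-- from these incidences. The points off F ∪ L are covered by the lines ⟨L+ e⟩ ∩ ((A ∩ F) ∨ e),
-- where A ⊇ L is a plane missing e.
module Submission where

open import Defs
open import Data.Nat using (ℕ; suc; _≟_; _+_; _≤_; _<_)
open import Data.Nat.Properties
  using (≤-refl; ≤-trans; ≤-antisym; ≤-reflexive; ≤∧≢⇒<; <⇒≱; n≤0⇒n≡0; +-comm; +-monoʳ-≤; +-mono-≤;
         +-cancelʳ-≤; +-cancelˡ-≡; m≤m+n)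
open import Data.Bool using (true)
import Data.Bool as Bool
open import Data.Fin using (Fin)
open import Data.Fin.Properties using (any?)
open import Data.Fin.Subset
open import Data.Fin.Subset.Properties
open import Data.Vec.Properties using (lookup∘tabulate; []=⇒lookup; lookup⇒[]=; ≡-dec)
open import Data.List using (List; []; _∷_; map; filter; allFin)
open import Data.List.Membership.Propositional using () renaming (_∈_ to _∈ₗ_)
open import Data.List.Membership.Propositional.Properties using (∈-filter⁺; ∈-allFin)
open import Data.List.Relation.Unary.All using (All; []; _∷_)
open import Data.List.Relation.Unary.All.Properties using (all-filter)
open import Data.List.Relation.Unary.Any using (here; there)
open import Data.Product using (Σ; ∃; _×_; _,_; proj₁; proj₂)
open import Data.Sum using (_⊎_; inj₁; inj₂; [_,_]′)
open import Data.Empty using (⊥-elim)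
open import Function using (_∘_; case_of_)
open import Relation.Nullary using (¬_; Dec; yes; no; does; contradiction; ¬?; _×-dec_)
open import Relation.Nullary.Decidable using (dec-true; decidable-stable)
open import Relation.Binary.PropositionalEquality
  using (_≡_; _≢_; refl; sym; trans; cong; cong₂; subst; subst₂)

module _ {n : ℕ} where

  _≟ₛ_ : (p q : Subset n) → Dec (p ≡ q)
  _≟ₛ_ = ≡-dec Bool._≟_

  ∪-least : ∀ {p q s : Subset n} → p ⊆ s → q ⊆ s → p ∪ q ⊆ s
  ∪-least {p} {q} p⊆s q⊆s x∈p∪q = [ p⊆s , q⊆s ]′ (x∈p∪q⁻ p q x∈p∪q)

  x∈p⇒⁅x⁆⊆p : ∀ {x} {p : Subset n} → x ∈ p → ⁅ x ⁆ ⊆ p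
  x∈p⇒⁅x⁆⊆p {x} x∈p y∈⁅x⁆ = subst (_∈ _) (sym (x∈⁅y⁆⇒x≡y x y∈⁅x⁆)) x∈p

  ∩≡⊥⁺ : ∀ {p q : Subset n} → (∀ {x} → x ∈ p → x ∉ q) → p ∩ q ≡ ⊥
  ∩≡⊥⁺ {p} {q} apart = Empty-unique λ (x , x∈p∩q) →
    let (x∈p , x∈q) = x∈p∩q⁻ p q x∈p∩q in apart x∈p x∈q

  ∩≡⊥⁻ : ∀ {p q : Subset n} {x} → p ∩ q ≡ ⊥ → x ∈ p → x ∉ q
  ∩≡⊥⁻ p∩q≡⊥ x∈p x∈q = ∉⊥ (subst (_ ∈_) p∩q≡⊥ (x∈p∩q⁺ (x∈p , x∈q)))

  ⊈⇒∃∉ : ∀ {p q : Subset n} → p ⊈ q → ∃ λ x → x ∈ p × x ∉ q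
  ⊈⇒∃∉ {p} {q} p⊈q with any? (λ x → x ∈? p ×-dec ¬? (x ∈? q))
  ... | yes witness = witness
  ... | no none = ⊥-elim (p⊈q λ {x} x∈p →
          decidable-stable (x ∈? q) (λ x∉q → none (x , x∈p , x∉q)))

does≡true⇒ : ∀ {P : Set} (P? : Dec P) → does P? ≡ true → P
does≡true⇒ (yes p) _ = p
does≡true⇒ (no _) ()

module MatroidProperties {m : ℕ} (M : Matroid m) where
  open Matroid M

  IsLine IsPlane : Subset m → Set
  IsLine K = IsFlat M K × r K ≡ 2
  IsPlane P = IsFlat M P × r P ≡ 3

  r-⊥ : r ⊥ ≡ 0
  r-⊥ = n≤0⇒n≡0 (subst (r ⊥ ≤_) (∣⊥∣≡0 m) (r-card ⊥))

  r-⁅⁆≤1 : ∀ e → r ⁅ e ⁆ ≤ 1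
  r-⁅⁆≤1 e = subst (r ⁅ e ⁆ ≤_) (∣⁅x⁆∣≡1 e) (r-card ⁅ e ⁆)

  r≡suc⇒Nonempty : ∀ {X k} → r X ≡ suc k → Nonempty X
  r≡suc⇒Nonempty {X} rX with nonempty? X
  ... | yes X≢∅ = X≢∅
  ... | no X≡∅ = contradiction (trans (sym rX) (trans (cong r (Empty-unique X≡∅)) r-⊥)) λ ()

  r-mono-≥ : ∀ {X Y} → X ⊆ Y → r Y ≤ r X → r Y ≡ r X
  r-mono-≥ X⊆Y rY≤rX = ≤-antisym rY≤rX (r-mono X⊆Y)

  ∈-cl⁻ : ∀ {X e} → e ∈ cl M X → r (X ∪ ⁅ e ⁆) ≡ r X
  ∈-cl⁻ {X} {e} e∈cl =
    does≡true⇒ (r (X ∪ ⁅ e ⁆) ≟ r X) (trans (sym (lookup∘tabulate _ e)) ([]=⇒lookup e∈cl))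

  ∈-cl⁺ : ∀ {X e} → r (X ∪ ⁅ e ⁆) ≡ r X → e ∈ cl M X
  ∈-cl⁺ {X} {e} eq = lookup⇒[]= e (cl M X)
    (trans (lookup∘tabulate _ e) (dec-true (r (X ∪ ⁅ e ⁆) ≟ r X) eq))

  ⊆-cl : ∀ {X} → X ⊆ cl M X
  ⊆-cl {X} e∈X = ∈-cl⁺ (r-mono-≥ (p⊆p∪q _) (r-mono (∪-least ⊆-refl (x∈p⇒⁅x⁆⊆p e∈X))))

  ⊆-cl-∪ˡ : ∀ {X Y} → X ⊆ cl M (X ∪ Y)
  ⊆-cl-∪ˡ {X} {Y} x∈X = ⊆-cl (p⊆p∪q Y x∈X)

  ⊆-cl-∪ʳ : ∀ {X Y} → Y ⊆ cl M (X ∪ Y)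
  ⊆-cl-∪ʳ {X} {Y} y∈Y = ⊆-cl (q⊆p∪q X Y y∈Y)

  r-∪-⁅⁆-cl : ∀ {X Y e} → X ⊆ Y → e ∈ cl M X → r (Y ∪ ⁅ e ⁆) ≡ r Y
  r-∪-⁅⁆-cl {X} {Y} {e} X⊆Y e∈clX = r-mono-≥ (p⊆p∪q _) (+-cancelʳ-≤ (r X) _ _ (begin
      r (Y ∪ ⁅ e ⁆) + r X              ≤⟨ +-mono-≤ (r-mono Y∪e⊆) (r-mono X⊆) ⟩
      r (Y ∪ Xe) + r (Y ∩ Xe)          ≤⟨ r-submod Y Xe ⟩
      r Y + r Xe                       ≡⟨ cong (r Y +_) (∈-cl⁻ e∈clX) ⟩
      r Y + r X                        ∎))
    where
      open Data.Nat.Properties.≤-Reasoning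
      Xe = X ∪ ⁅ e ⁆
      Y∪e⊆ : Y ∪ ⁅ e ⁆ ⊆ Y ∪ Xe
      Y∪e⊆ = ∪-least (p⊆p∪q Xe) (⊆-trans (q⊆p∪q X ⁅ e ⁆) (q⊆p∪q Y Xe))
      X⊆ : X ⊆ Y ∩ Xe
      X⊆ x∈X = x∈p∩q⁺ (X⊆Y x∈X , p⊆p∪q ⁅ e ⁆ x∈X)

  cl-least : ∀ {X Y} → X ⊆ Y → IsFlat M Y → cl M X ⊆ Y
  cl-least X⊆Y flatY e∈clX = subst (_ ∈_) flatY (∈-cl⁺ (r-∪-⁅⁆-cl X⊆Y e∈clX))

  ∈-⋃⁅⁆ : ∀ {e : Fin m} {es} → e ∈ₗ es → e ∈ ⋃ (map ⁅_⁆ es)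
  ∈-⋃⁅⁆ {e} (here refl) = p⊆p∪q _ (x∈⁅x⁆ e)
  ∈-⋃⁅⁆ {es = e′ ∷ _} (there e∈es) = q⊆p∪q ⁅ e′ ⁆ _ (∈-⋃⁅⁆ e∈es)

  r-∪-⋃⁅⁆-cl : ∀ {X} (es : List (Fin m)) → All (_∈ cl M X) es → r (X ∪ ⋃ (map ⁅_⁆ es)) ≡ r X
  r-∪-⋃⁅⁆-cl {X} [] [] = cong r (∪-identityʳ X)
  r-∪-⋃⁅⁆-cl {X} (e ∷ es) (e∈clX ∷ es⊆clX) = begin
    r (X ∪ (⁅ e ⁆ ∪ U))  ≡⟨ cong r (trans (cong (X ∪_) (∪-comm ⁅ e ⁆ U)) (sym (∪-assoc X U ⁅ e ⁆))) ⟩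
    r ((X ∪ U) ∪ ⁅ e ⁆)  ≡⟨ r-∪-⁅⁆-cl (p⊆p∪q U) e∈clX ⟩
    r (X ∪ U)            ≡⟨ r-∪-⋃⁅⁆-cl es es⊆clX ⟩
    r X                  ∎
    where
      open Relation.Binary.PropositionalEquality.≡-Reasoning
      U = ⋃ (map ⁅_⁆ es)

  r-cl : ∀ X → r (cl M X) ≡ r X
  r-cl X = r-mono-≥ ⊆-cl
    (≤-trans (r-mono clX⊆) (≤-reflexive (r-∪-⋃⁅⁆-cl es (all-filter (_∈? cl M X) (allFin m)))))
    where
      es : List (Fin m)
      es = filter (_∈? cl M X) (allFin m)
      clX⊆ : cl M X ⊆ X ∪ ⋃ (map ⁅_⁆ es)
      clX⊆ {e} e∈clX = q⊆p∪q X _ (∈-⋃⁅⁆ (∈-filter⁺ (_∈? cl M X) (∈-allFin e) e∈clX))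

  cl-isFlat : ∀ X → IsFlat M (cl M X)
  cl-isFlat X = ⊆-antisym clclX⊆clX ⊆-cl
    where
      clclX⊆clX : cl M (cl M X) ⊆ cl M X
      clclX⊆clX {e} e∈clclX = ∈-cl⁺ (r-mono-≥ (p⊆p∪q _) (begin
        r (X ∪ ⁅ e ⁆)       ≤⟨ r-mono (∪-least (⊆-trans ⊆-cl (p⊆p∪q _)) (q⊆p∪q _ _)) ⟩
        r (cl M X ∪ ⁅ e ⁆)  ≡⟨ ∈-cl⁻ e∈clclX ⟩
        r (cl M X)          ≡⟨ r-cl X ⟩
        r X                 ∎))
        where open Data.Nat.Properties.≤-Reasoning

  ⊆-cl-of-r≤ : ∀ {X Y} → X ⊆ Y → r Y ≤ r X → Y ⊆ cl M X
  ⊆-cl-of-r≤ X⊆Y rY≤rX e∈Y =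
    ∈-cl⁺ (r-mono-≥ (p⊆p∪q _) (≤-trans (r-mono (∪-least X⊆Y (x∈p⇒⁅x⁆⊆p e∈Y))) rY≤rX))

  cl≡flat-of-r≤ : ∀ {X P} → X ⊆ P → IsFlat M P → r P ≤ r X → cl M X ≡ P
  cl≡flat-of-r≤ X⊆P flatP rP≤rX = ⊆-antisym (cl-least X⊆P flatP) (⊆-cl-of-r≤ X⊆P rP≤rX)

  flats-≡-of-r≤ : ∀ {X P Q} → X ⊆ P → IsFlat M P → r P ≤ r X →
                  X ⊆ Q → IsFlat M Q → r Q ≤ r X → P ≡ Q
  flats-≡-of-r≤ X⊆P flatP rP≤rX X⊆Q flatQ rQ≤rX =
    trans (sym (cl≡flat-of-r≤ X⊆P flatP rP≤rX)) (cl≡flat-of-r≤ X⊆Q flatQ rQ≤rX)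

  ∩-isFlat : ∀ {X Y} → IsFlat M X → IsFlat M Y → IsFlat M (X ∩ Y)
  ∩-isFlat {X} {Y} flatX flatY = ⊆-antisym
    (λ e∈cl → x∈p∩q⁺ (cl-least (p∩q⊆p X Y) flatX e∈cl , cl-least (p∩q⊆q X Y) flatY e∈cl)) ⊆-cl

  r-∪-⁅⁆-∉cl : ∀ {X e} → e ∉ cl M X → r (X ∪ ⁅ e ⁆) ≡ suc (r X)
  r-∪-⁅⁆-∉cl {X} {e} e∉clX = ≤-antisym upper (≤∧≢⇒< (r-mono (p⊆p∪q _)) (e∉clX ∘ ∈-cl⁺ ∘ sym))
    where
      upper : r (X ∪ ⁅ e ⁆) ≤ suc (r X)
      upper = begin
        r (X ∪ ⁅ e ⁆)                         ≤⟨ m≤m+n _ _ ⟩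
        r (X ∪ ⁅ e ⁆) + r (X ∩ ⁅ e ⁆)         ≤⟨ r-submod X ⁅ e ⁆ ⟩
        r X + r ⁅ e ⁆                         ≤⟨ +-monoʳ-≤ (r X) (r-⁅⁆≤1 e) ⟩
        r X + 1                               ≡⟨ +-comm (r X) 1 ⟩
        suc (r X)                             ∎
        where open Data.Nat.Properties.≤-Reasoning

  r-∪-flats-> : ∀ {K K′} → IsFlat M K → IsFlat M K′ → r K ≡ r K′ → K ≢ K′ → r K < r (K ∪ K′)
  r-∪-flats-> {K} {K′} flatK flatK′ rK≡rK′ K≢K′ = ≤∧≢⇒< (r-mono (p⊆p∪q K′)) λ rK≡ →
    K≢K′ (flats-≡-of-r≤ (K′⊆K (sym rK≡)) flatK (≤-reflexive rK≡rK′) ⊆-refl flatK′ ≤-refl)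
    where
      K′⊆K : r (K ∪ K′) ≡ r K → K′ ⊆ K
      K′⊆K rK∪K′≡rK =
        ⊆-trans (q⊆p∪q K K′) (subst (_ ⊆_) flatK (⊆-cl-of-r≤ (p⊆p∪q K′) (≤-reflexive rK∪K′≡rK)))

  cl-isPlane : ∀ {X} → r X ≡ 3 → IsPlane (cl M X)
  cl-isPlane {X} rX = cl-isFlat X , trans (r-cl X) rX

  r-line∪point : ∀ {K e} → IsLine K → e ∉ K → r (K ∪ ⁅ e ⁆) ≡ 3
  r-line∪point (flatK , rK) e∉K = trans (r-∪-⁅⁆-∉cl (e∉K ∘ subst (_ ∈_) flatK)) (cong suc rK)

  r-lines-in-plane : ∀ {K K′ P} → IsLine K → IsLine K′ → K ≢ K′ → IsPlane P → K ⊆ P → K′ ⊆ P →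
                     r (K ∪ K′) ≡ 3
  r-lines-in-plane {K} {K′} (flatK , rK) (flatK′ , rK′) K≢K′ (_ , rP) K⊆P K′⊆P = ≤-antisym
    (≤-trans (r-mono (∪-least K⊆P K′⊆P)) (≤-reflexive rP))
    (subst (_< r (K ∪ K′)) rK (r-∪-flats-> flatK flatK′ (trans rK (sym rK′)) K≢K′))

  cl[line∪point]≡plane : ∀ {K e P} → IsLine K → e ∉ K → IsPlane P → K ⊆ P → e ∈ P →
                         cl M (K ∪ ⁅ e ⁆) ≡ P
  cl[line∪point]≡plane lineK e∉K (flatP , rP) K⊆P e∈P =
    cl≡flat-of-r≤ (∪-least K⊆P (x∈p⇒⁅x⁆⊆p e∈P)) flatP
      (≤-reflexive (trans rP (sym (r-line∪point lineK e∉K))))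

  cl[lines]≡plane : ∀ {K K′ P} → IsLine K → IsLine K′ → K ≢ K′ → IsPlane P → K ⊆ P → K′ ⊆ P →
                    cl M (K ∪ K′) ≡ P
  cl[lines]≡plane lineK lineK′ K≢K′ planeP@(flatP , rP) K⊆P K′⊆P =
    cl≡flat-of-r≤ (∪-least K⊆P K′⊆P) flatP
    (≤-reflexive (trans rP (sym (r-lines-in-plane lineK lineK′ K≢K′ planeP K⊆P K′⊆P))))

  plane-unique-∋line+point : ∀ {K e P Q} → IsLine K → e ∉ K → IsPlane P → IsPlane Q →
                             K ⊆ P → e ∈ P → K ⊆ Q → e ∈ Q → P ≡ Q
  plane-unique-∋line+point lineK e∉K planeP planeQ K⊆P e∈P K⊆Q e∈Q =
    trans (sym (cl[line∪point]≡plane lineK e∉K planeP K⊆P e∈P))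
          (cl[line∪point]≡plane lineK e∉K planeQ K⊆Q e∈Q)

  plane-unique-∋lines : ∀ {K K′ P Q} → IsLine K → IsLine K′ → K ≢ K′ → IsPlane P → IsPlane Q →
                        K ⊆ P → K′ ⊆ P → K ⊆ Q → K′ ⊆ Q → P ≡ Q
  plane-unique-∋lines lineK lineK′ K≢K′ planeP planeQ K⊆P K′⊆P K⊆Q K′⊆Q =
    trans (sym (cl[lines]≡plane lineK lineK′ K≢K′ planeP K⊆P K′⊆P))
          (cl[lines]≡plane lineK lineK′ K≢K′ planeQ K⊆Q K′⊆Q)

  ⊂-of-r< : ∀ {X Y} → X ⊆ Y → r X < r Y → X ⊂ Y
  ⊂-of-r< X⊆Y rX<rY = X⊆Y , ⊈⇒∃∉ (λ Y⊆X → <⇒≱ rX<rY (r-mono Y⊆X))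

  line⊂plane : ∀ {K P} → IsLine K → IsPlane P → K ⊆ P → K ⊂ P
  line⊂plane (_ , rK) (_ , rP) K⊆P = ⊂-of-r< K⊆P (subst₂ _<_ (sym rK) (sym rP) ≤-refl)

  lines-⊆⇒≡ : ∀ {K K′} → IsLine K → IsLine K′ → K ⊆ K′ → K ≡ K′
  lines-⊆⇒≡ (flatK , rK) (flatK′ , rK′) K⊆K′ =
    flats-≡-of-r≤ ⊆-refl flatK ≤-refl K⊆K′ flatK′ (≤-reflexive (trans rK′ (sym rK)))

  line≡cl-points : Loopless M → ∀ {X x y} → IsLine X → x ∈ X → y ∈ X → y ∉ cl M ⁅ x ⁆ →
                   cl M (⁅ x ⁆ ∪ ⁅ y ⁆) ≡ X
  line≡cl-points loopless {x = x} (flatX , rX) x∈X y∈X y∉cl⁅x⁆ =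
    cl≡flat-of-r≤ (∪-least (x∈p⇒⁅x⁆⊆p x∈X) (x∈p⇒⁅x⁆⊆p y∈X)) flatX
      (≤-reflexive (trans rX (sym (trans (r-∪-⁅⁆-∉cl y∉cl⁅x⁆) (cong suc (loopless x))))))

module RankFourHypermodular {m : ℕ} (M : Matroid m) (hyp : Hypermodular M) where
  open Matroid M
  open MatroidProperties M

  r≤4 : ∀ X → r X ≤ 4
  r≤4 X = subst (r X ≤_) (proj₁ hyp) (r-mono ⊆⊤)

  ∃∉plane : ∀ {P} → IsPlane P → ∃ λ z → z ∉ P
  ∃∉plane {P} (_ , rP) =
    let (z , _ , z∉P) = ⊈⇒∃∉ (λ ⊤⊆P → <⇒≱ rP<r⊤ (r-mono ⊤⊆P)) in z , z∉P
    where
      rP<r⊤ : r P < r ⊤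
      rP<r⊤ = subst₂ _<_ (sym rP) (sym (proj₁ hyp)) ≤-refl

  planes-∩-isLine : ∀ {P Q} → IsPlane P → IsPlane Q → P ≢ Q → IsLine (P ∩ Q)
  planes-∩-isLine {P} {Q} (flatP , rP) (flatQ , rQ) P≢Q =
    ∩-isFlat flatP flatQ , +-cancelˡ-≡ 4 _ _ (begin
      4 + r (P ∩ Q)             ≡⟨ cong (_+ r (P ∩ Q)) (sym rP∪Q) ⟩
      r (P ∪ Q) + r (P ∩ Q)     ≡⟨ proj₂ hyp P Q flatP rP flatQ rQ ⟩
      r P + r Q                 ≡⟨ cong₂ _+_ rP rQ ⟩
      4 + 2                     ∎)
    where
      open Relation.Binary.PropositionalEquality.≡-Reasoning
      rP∪Q : r (P ∪ Q) ≡ 4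
      rP∪Q = ≤-antisym (r≤4 _)
        (subst (_< r (P ∪ Q)) rP (r-∪-flats-> flatP flatQ (trans rP (sym rQ)) P≢Q))

module Configuration {m : ℕ} (M : Matroid m) (hyp : Hypermodular M) (F L : Subset m)
  (planeF : MatroidProperties.IsPlane M F) (lineL : MatroidProperties.IsLine M L)
  (F∩L≡⊥ : F ∩ L ≡ ⊥) where
  open Matroid M
  open MatroidProperties M
  open RankFourHypermodular M hyp
  open Setting M F L

  ∈F⇒∉L : ∀ {e} → e ∈ F → e ∉ L
  ∈F⇒∉L = ∩≡⊥⁻ F∩L≡⊥

  ⟨L+_⟩ : Fin m → Subset m
  ⟨L+ e ⟩ = cl M (L ∪ ⁅ e ⁆)

  ⟨L+⟩-isPlane : ∀ {e} → e ∉ L → IsPlane ⟨L+ e ⟩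
  ⟨L+⟩-isPlane e∉L = cl-isPlane (r-line∪point lineL e∉L)

  L⊆⟨L+⟩ : ∀ {e} → L ⊆ ⟨L+ e ⟩
  L⊆⟨L+⟩ = ⊆-cl-∪ˡ

  ∈⟨L+⟩ : ∀ e → e ∈ ⟨L+ e ⟩
  ∈⟨L+⟩ e = ⊆-cl-∪ʳ (x∈⁅x⁆ e)

  planes-⊇L-≡ : ∀ {A A′ t} → IsPlane A → IsPlane A′ → L ⊆ A → L ⊆ A′ →
                t ∉ L → t ∈ A → t ∈ A′ → A ≡ A′
  planes-⊇L-≡ planeA planeA′ L⊆A L⊆A′ t∉L t∈A t∈A′ =
    plane-unique-∋line+point lineL t∉L planeA planeA′ L⊆A t∈A L⊆A′ t∈A′

  L-nonempty : Nonempty L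
  L-nonempty = r≡suc⇒Nonempty (proj₂ lineL)

  L≢trace : ∀ {A} → L ≢ A ∩ F
  L≢trace {A} L≡A∩F = let (l , l∈L) = L-nonempty in
    ∈F⇒∉L (p∩q⊆q A F (subst (l ∈_) L≡A∩F l∈L)) l∈L

  ⊇L⇒≢F : ∀ {A} → L ⊆ A → A ≢ F
  ⊇L⇒≢F L⊆A refl = let (l , l∈L) = L-nonempty in ∈F⇒∉L (L⊆A l∈L) l∈L

  trace-∈𝒯 : ∀ {A} → IsPlane A → L ⊆ A → 𝒯 (A ∩ F)
  trace-∈𝒯 (flatA , rA) L⊆A = inj₂ (_ , flatA , rA , L⊆A , refl)

  𝒯-isLine : ∀ {T} → 𝒯 T → IsLine T
  𝒯-isLine (inj₁ refl) = lineL
  𝒯-isLine (inj₂ (A , flatA , rA , L⊆A , refl)) = planes-∩-isLine (flatA , rA) planeF (⊇L⇒≢F L⊆A)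

  𝒯⊆F∪L : ∀ {T} → 𝒯 T → T ⊆ F ∪ L
  𝒯⊆F∪L (inj₁ refl) = q⊆p∪q F L
  𝒯⊆F∪L (inj₂ (A , _ , _ , _ , refl)) = ⊆-trans (p∩q⊆q A F) (p⊆p∪q L)

  𝒥₊-isLine : ∀ {J} → 𝒥₊ J → IsLine J
  𝒥₊-isLine (inj₁ (flatJ , rJ , _)) = flatJ , rJ
  𝒥₊-isLine (inj₂ T∈𝒯) = 𝒯-isLine T∈𝒯

  𝒥₊-nonempty : ∀ J → 𝒥₊ J → Nonempty J
  𝒥₊-nonempty J J∈𝒥₊ = r≡suc⇒Nonempty (proj₂ (𝒥₊-isLine J∈𝒥₊))

  𝒥-∉F∪L : ∀ {J e} → 𝒥 J → e ∈ J → e ∉ F ∪ L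
  𝒥-∉F∪L (_ , _ , J∩F∪L≡⊥ , _) = ∩≡⊥⁻ J∩F∪L≡⊥

  𝒥≢𝒯 : ∀ {J T} → 𝒥 J → 𝒯 T → J ≢ T
  𝒥≢𝒯 J∈𝒥 T∈𝒯 refl = let (t , t∈T) = 𝒥₊-nonempty _ (inj₂ T∈𝒯) in
    𝒥-∉F∪L J∈𝒥 t∈T (𝒯⊆F∪L T∈𝒯 t∈T)

  another-plane-⊇L : ∀ {A} → IsPlane A → L ⊆ A → ∃ λ A′ → IsPlane A′ × L ⊆ A′ × A′ ≢ A
  another-plane-⊇L {A} planeA L⊆A = let (z , z∉A) = ∃∉plane planeA in
    ⟨L+ z ⟩ , ⟨L+⟩-isPlane (z∉A ∘ L⊆A) , L⊆⟨L+⟩ , λ eq → z∉A (subst (z ∈_) eq (∈⟨L+⟩ z))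

  -- The two planes cutting out J are the two elements of (J ∨ 𝒯)^(3).
  module LineThrough {e A} (e∉F : e ∉ F) (e∉L : e ∉ L) (planeA : IsPlane A) (L⊆A : L ⊆ A)
    (e∉A : e ∉ A) where

    T B J : Subset m
    T = A ∩ F
    B = cl M (T ∪ ⁅ e ⁆)
    J = ⟨L+ e ⟩ ∩ B

    lineT : IsLine T
    lineT = 𝒯-isLine (trace-∈𝒯 planeA L⊆A)

    e∉T : e ∉ T
    e∉T = e∉F ∘ p∩q⊆q A F

    planeB : IsPlane B
    planeB = cl-isPlane (r-line∪point lineT e∉T)

    e∈B : e ∈ B
    e∈B = ⊆-cl-∪ʳ (x∈⁅x⁆ e)

    ⟨L+e⟩≢A : ⟨L+ e ⟩ ≢ A
    ⟨L+e⟩≢A eq = e∉A (subst (e ∈_) eq (∈⟨L+⟩ e))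

    B≢⟨L+e⟩ : B ≢ ⟨L+ e ⟩
    B≢⟨L+e⟩ eq = let (t , t∈T) = r≡suc⇒Nonempty (proj₂ lineT) in
      ⟨L+e⟩≢A (planes-⊇L-≡ (⟨L+⟩-isPlane e∉L) planeA L⊆⟨L+⟩ L⊆A (∈F⇒∉L (p∩q⊆q A F t∈T))
                 (subst (t ∈_) eq (⊆-cl-∪ˡ t∈T)) (p∩q⊆p A F t∈T))

    lineJ : IsLine J
    lineJ = planes-∩-isLine (⟨L+⟩-isPlane e∉L) planeB (B≢⟨L+e⟩ ∘ sym)

    e∈J : e ∈ J
    e∈J = x∈p∩q⁺ (∈⟨L+⟩ e , e∈B)

    J⊆B : J ⊆ B
    J⊆B = p∩q⊆q ⟨L+ e ⟩ B

    B≡plane : ∀ {x P} → x ∈ J → x ∉ T → IsPlane P → T ⊆ P → x ∈ P → B ≡ P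
    B≡plane x∈J x∉T planeP T⊆P x∈P =
      plane-unique-∋line+point lineT x∉T planeB planeP ⊆-cl-∪ˡ (J⊆B x∈J) T⊆P x∈P

    J∌F : ∀ {x} → x ∈ J → x ∉ F
    J∌F x∈J x∈F = e∉F (subst (e ∈_) (B≡plane x∈J x∉T planeF (p∩q⊆q A F) x∈F) e∈B)
      where
        x∉T : _ ∉ T
        x∉T x∈T = ⟨L+e⟩≢A (planes-⊇L-≡ (⟨L+⟩-isPlane e∉L) planeA L⊆⟨L+⟩ L⊆A (∈F⇒∉L x∈F)
                              (p∩q⊆p ⟨L+ e ⟩ B x∈J) (p∩q⊆p A F x∈T))

    J∌L : ∀ {x} → x ∈ J → x ∉ L
    J∌L x∈J x∈L = e∉A (subst (e ∈_) (B≡plane x∈J x∉T planeA (p∩q⊆p A F) (L⊆A x∈L)) e∈B)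
      where
        x∉T : _ ∉ T
        x∉T x∈T = ∈F⇒∉L (p∩q⊆q A F x∈T) x∈L

    J∩F∪L≡⊥ : J ∩ (F ∪ L) ≡ ⊥
    J∩F∪L≡⊥ = ∩≡⊥⁺ λ x∈J x∈F∪L → [ J∌F x∈J , J∌L x∈J ]′ (x∈p∪q⁻ F L x∈F∪L)

    J≢trace : ∀ {X} → J ≢ X ∩ F
    J≢trace {X} eq = e∉F (p∩q⊆q X F (subst (e ∈_) eq e∈J))

    J-AtLeastTwo : AtLeastTwo J
    J-AtLeastTwo = ⟨L+ e ⟩ ∩ F , T , Tₑ∈𝒯 , trace-∈𝒯 planeA L⊆A ,
      r-lines-in-plane lineJ lineTₑ J≢trace planeLe J⊆⟨L+e⟩ Tₑ⊆⟨L+e⟩ ,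
      r-lines-in-plane lineJ lineT J≢trace planeB J⊆B ⊆-cl-∪ˡ ,
      λ eq → B≢⟨L+e⟩ (trans (sym (cl[lines]≡plane lineJ lineT J≢trace planeB J⊆B ⊆-cl-∪ˡ))
        (trans (sym eq) (cl[lines]≡plane lineJ lineTₑ J≢trace planeLe J⊆⟨L+e⟩ Tₑ⊆⟨L+e⟩)))
      where
        planeLe : IsPlane ⟨L+ e ⟩
        planeLe = ⟨L+⟩-isPlane e∉L
        Tₑ∈𝒯 : 𝒯 (⟨L+ e ⟩ ∩ F)
        Tₑ∈𝒯 = trace-∈𝒯 planeLe L⊆⟨L+⟩
        lineTₑ : IsLine (⟨L+ e ⟩ ∩ F)
        lineTₑ = 𝒯-isLine Tₑ∈𝒯
        Tₑ⊆⟨L+e⟩ : ⟨L+ e ⟩ ∩ F ⊆ ⟨L+ e ⟩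
        Tₑ⊆⟨L+e⟩ = p∩q⊆p ⟨L+ e ⟩ F
        J⊆⟨L+e⟩ : J ⊆ ⟨L+ e ⟩
        J⊆⟨L+e⟩ = p∩q⊆p ⟨L+ e ⟩ B

  𝒥-through : ∀ {e A} → e ∉ F → e ∉ L → IsPlane A → L ⊆ A → e ∉ A →
              ∃ λ J → 𝒥 J × e ∈ J × J ⊆ cl M ((A ∩ F) ∪ ⁅ e ⁆)
  𝒥-through e∉F e∉L planeA L⊆A e∉A =
    J , (proj₁ lineJ , proj₂ lineJ , J∩F∪L≡⊥ , J-AtLeastTwo) , e∈J , J⊆B
    where open LineThrough e∉F e∉L planeA L⊆A e∉A

  𝒥-off-F∪L : ∀ {e} → e ∉ F → e ∉ L → ∃ λ J → 𝒥 J × e ∈ J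
  𝒥-off-F∪L {e} e∉F e∉L =
    let (A , planeA , L⊆A , A≢⟨L+e⟩) = another-plane-⊇L planeLe L⊆⟨L+⟩
        (J , J∈𝒥 , e∈J , _) = 𝒥-through e∉F e∉L planeA L⊆A λ e∈A →
          A≢⟨L+e⟩ (planes-⊇L-≡ planeA planeLe L⊆A L⊆⟨L+⟩ e∉L e∈A (∈⟨L+⟩ e))
    in J , J∈𝒥 , e∈J
    where
      planeLe : IsPlane ⟨L+ e ⟩
      planeLe = ⟨L+⟩-isPlane e∉L

  𝒯-covers : ∀ {e} → e ∈ F ∪ L → ∃ λ T → 𝒯 T × e ∈ T
  𝒯-covers {e} e∈F∪L = [ on-F , on-L ]′ (x∈p∪q⁻ F L e∈F∪L)
    where
      on-F : e ∈ F → ∃ λ T → 𝒯 T × e ∈ T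
      on-F e∈F = ⟨L+ e ⟩ ∩ F , trace-∈𝒯 (⟨L+⟩-isPlane (∈F⇒∉L e∈F)) L⊆⟨L+⟩ , x∈p∩q⁺ (∈⟨L+⟩ e , e∈F)
      on-L : e ∈ L → ∃ λ T → 𝒯 T × e ∈ T
      on-L e∈L = L , inj₁ refl , e∈L

  𝒥₊-covers : ∀ e → ∃ λ J → 𝒥₊ J × e ∈ J
  𝒥₊-covers e = case e ∈? F ∪ L of λ where
    (yes e∈F∪L) → let (T , T∈𝒯 , e∈T) = 𝒯-covers e∈F∪L in T , inj₂ T∈𝒯 , e∈T
    (no e∉F∪L) → let (J , J∈𝒥 , e∈J) = 𝒥-off-F∪L (e∉F∪L ∘ p⊆p∪q L) (e∉F∪L ∘ q⊆p∪q F L) in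
                 J , inj₁ J∈𝒥 , e∈J

  𝒯-meet⇒≡ : ∀ {T T′ e} → 𝒯 T → 𝒯 T′ → e ∈ T → e ∈ T′ → T ≡ T′
  𝒯-meet⇒≡ (inj₁ refl) (inj₁ refl) _ _ = refl
  𝒯-meet⇒≡ (inj₁ refl) (inj₂ (A , _ , _ , _ , refl)) e∈L e∈A∩F = ⊥-elim (∈F⇒∉L (p∩q⊆q A F e∈A∩F) e∈L)
  𝒯-meet⇒≡ (inj₂ (A , _ , _ , _ , refl)) (inj₁ refl) e∈A∩F e∈L = ⊥-elim (∈F⇒∉L (p∩q⊆q A F e∈A∩F) e∈L)
  𝒯-meet⇒≡ (inj₂ (A , flatA , rA , L⊆A , refl)) (inj₂ (A′ , flatA′ , rA′ , L⊆A′ , refl)) e∈A∩F e∈A′∩F =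
    cong (_∩ F) (planes-⊇L-≡ (flatA , rA) (flatA′ , rA′) L⊆A L⊆A′ (∈F⇒∉L (p∩q⊆q A F e∈A∩F))
                             (p∩q⊆p A F e∈A∩F) (p∩q⊆p A′ F e∈A′∩F))

  joinOfPair-⊇ : ∀ {J J′ X} → 𝒥₊ J → 𝒥₊ J′ → J ≢ J′ → IsPlane X → J ⊆ X → J′ ⊆ X → JoinOfPair X
  joinOfPair-⊇ J∈𝒥₊ J′∈𝒥₊ J≢J′ planeX J⊆X J′⊆X = _ , _ , J∈𝒥₊ , J′∈𝒥₊ , J≢J′ ,
    sym (cl[lines]≡plane (𝒥₊-isLine J∈𝒥₊) (𝒥₊-isLine J′∈𝒥₊) J≢J′ planeX J⊆X J′⊆X)

  joinOfPair-⊇L : ∀ {A} → IsPlane A → L ⊆ A → JoinOfPair A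
  joinOfPair-⊇L {A} planeA L⊆A =
    joinOfPair-⊇ (inj₂ (inj₁ refl)) (inj₂ (trace-∈𝒯 planeA L⊆A)) L≢trace planeA L⊆A (p∩q⊆p A F)

  trace-injective : ∀ {A A′} → IsPlane A → IsPlane A′ → L ⊆ A → L ⊆ A′ → A ∩ F ≡ A′ ∩ F → A ≡ A′
  trace-injective {A} {A′} planeA planeA′ L⊆A L⊆A′ A∩F≡A′∩F =
    let (t , t∈A∩F) = r≡suc⇒Nonempty (proj₂ (𝒯-isLine (trace-∈𝒯 planeA L⊆A))) in
    planes-⊇L-≡ planeA planeA′ L⊆A L⊆A′ (∈F⇒∉L (p∩q⊆q A F t∈A∩F))
      (p∩q⊆p A F t∈A∩F) (p∩q⊆p A′ F (subst (t ∈_) A∩F≡A′∩F t∈A∩F))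

  joinOfPair-F : ∀ {A} → IsPlane A → L ⊆ A → JoinOfPair F
  joinOfPair-F {A} planeA L⊆A = let (A′ , planeA′ , L⊆A′ , A′≢A) = another-plane-⊇L planeA L⊆A in
    joinOfPair-⊇ (inj₂ (trace-∈𝒯 planeA L⊆A)) (inj₂ (trace-∈𝒯 planeA′ L⊆A′))
      (A′≢A ∘ sym ∘ trace-injective planeA planeA′ L⊆A L⊆A′) planeF (p∩q⊆q A F) (p∩q⊆q A′ F)

  joinOfPair-through : ∀ {A X e} → IsPlane A → L ⊆ A → IsPlane X → A ∩ F ⊆ X →
                       e ∈ X → e ∉ F → e ∉ A → JoinOfPair X
  joinOfPair-through {A} {X} {e} planeA L⊆A planeX T⊆X e∈X e∉F e∉A =
    let (J , J∈𝒥 , e∈J , J⊆T∨e) = 𝒥-through e∉F (e∉A ∘ L⊆A) planeA L⊆A e∉A in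
    joinOfPair-⊇ (inj₁ J∈𝒥) (inj₂ T∈𝒯) (λ J≡T → e∉T (subst (e ∈_) J≡T e∈J)) planeX
      (subst (J ⊆_) (cl[line∪point]≡plane (𝒯-isLine T∈𝒯) e∉T planeX T⊆X e∈X) J⊆T∨e) T⊆X
    where
      T∈𝒯 : 𝒯 (A ∩ F)
      T∈𝒯 = trace-∈𝒯 planeA L⊆A
      e∉T : e ∉ A ∩ F
      e∉T = e∉F ∘ p∩q⊆q A F

  joinOfPair-⊇trace : ∀ {A X} → IsPlane A → L ⊆ A → IsPlane X → A ∩ F ⊆ X → X ≢ A → X ≢ F →
                      JoinOfPair X
  joinOfPair-⊇trace {A} {X} planeA L⊆A planeX T⊆X X≢A X≢F =
    let (_ , e , e∈X , e∉T) = line⊂plane lineT planeX T⊆X in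
    joinOfPair-through planeA L⊆A planeX T⊆X e∈X
      (X≢F ∘ X≡plane e∉T e∈X planeF (p∩q⊆q A F)) (X≢A ∘ X≡plane e∉T e∈X planeA (p∩q⊆p A F))
    where
      lineT : IsLine (A ∩ F)
      lineT = 𝒯-isLine (trace-∈𝒯 planeA L⊆A)
      X≡plane : ∀ {e P} → e ∉ A ∩ F → e ∈ X → IsPlane P → A ∩ F ⊆ P → e ∈ P → X ≡ P
      X≡plane e∉T e∈X planeP T⊆P e∈P =
        plane-unique-∋line+point lineT e∉T planeX planeP T⊆X e∈X T⊆P e∈P

  ∉𝒥₊⇒≢ : ∀ {X J} → ¬ 𝒥₊ X → 𝒥₊ J → X ≢ J
  ∉𝒥₊⇒≢ X∉𝒥₊ J∈𝒥₊ refl = X∉𝒥₊ J∈𝒥₊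

  -- Covering two points x, y of X by blocks Jx ∌ y and Jy of 𝒥₊.
  line∉𝒥₊-⊆-join : Loopless M → ∀ {X} → IsLine X → ¬ 𝒥₊ X →
                    ∃ λ J → ∃ λ J′ → 𝒥₊ J × 𝒥₊ J′ × J ≢ J′ × X ⊆ cl M (J ∪ J′)
  line∉𝒥₊-⊆-join loopless {X} lineX X∉𝒥₊ =
    let (x , x∈X) = r≡suc⇒Nonempty (proj₂ lineX)
        (Jx , Jx∈𝒥₊ , x∈Jx) = 𝒥₊-covers x
        (y , y∈X , y∉Jx) = ⊈⇒∃∉ (∉𝒥₊⇒≢ X∉𝒥₊ Jx∈𝒥₊ ∘ lines-⊆⇒≡ lineX (𝒥₊-isLine Jx∈𝒥₊))
        (Jy , Jy∈𝒥₊ , y∈Jy) = 𝒥₊-covers y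
        y∉cl⁅x⁆ = y∉Jx ∘ cl-least (x∈p⇒⁅x⁆⊆p x∈Jx) (proj₁ (𝒥₊-isLine Jx∈𝒥₊))
    in Jx , Jy , Jx∈𝒥₊ , Jy∈𝒥₊ , (λ Jx≡Jy → y∉Jx (subst (y ∈_) (sym Jx≡Jy) y∈Jy)) ,
       subst (_⊆ cl M (Jx ∪ Jy)) (line≡cl-points loopless lineX x∈X y∈X y∉cl⁅x⁆)
         (cl-least (∪-least (x∈p⇒⁅x⁆⊆p (⊆-cl-∪ˡ x∈Jx)) (x∈p⇒⁅x⁆⊆p (⊆-cl-∪ʳ y∈Jy))) (cl-isFlat _))

  join-∈𝒥♯ : ∀ {X T} → 𝒯 T → r (X ∪ T) ≡ 3 → 𝒥♯ (cl M (X ∪ T))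
  join-∈𝒥♯ T∈𝒯 rX∪T = cl-isFlat _ , trans (r-cl _) rX∪T , _ , T∈𝒯 , ⊆-cl-∪ʳ

  module JoinsIn𝒥♯ (joins∈𝒥♯ : ∀ J J′ → 𝒥₊ J → 𝒥₊ J′ → J ≢ J′ → 𝒥♯ (cl M (J ∪ J′))) where

    join-isPlane : ∀ {J J′} → 𝒥₊ J → 𝒥₊ J′ → J ≢ J′ → IsPlane (cl M (J ∪ J′))
    join-isPlane J∈𝒥₊ J′∈𝒥₊ J≢J′ = let (flat , rank , _) = joins∈𝒥♯ _ _ J∈𝒥₊ J′∈𝒥₊ J≢J′ in flat , rank

    -- Each plane J ∨ T equals J′ ∨ T (both contain T and the common point), so it contains J and
    -- J′ and is J ∨ J′: the set (J ∨ 𝒯)^(3) would have one element.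
    distinct-𝒥-disjoint : ∀ {J J′ e} → 𝒥 J → 𝒥 J′ → J ≢ J′ → e ∈ J → e ∉ J′
    distinct-𝒥-disjoint {J} {J′} {e} J∈𝒥@(_ , _ , _ , _ , _ , T₁∈𝒯 , T₂∈𝒯 , rJ∪T₁ , rJ∪T₂ , joins≢)
      J′∈𝒥 J≢J′ e∈J e∈J′ = joins≢ (trans (J∨T≡J∨J′ T₁∈𝒯 rJ∪T₁) (sym (J∨T≡J∨J′ T₂∈𝒯 rJ∪T₂)))
      where
        J∨T≡J∨J′ : ∀ {T} → 𝒯 T → r (J ∪ T) ≡ 3 → cl M (J ∪ T) ≡ cl M (J ∪ J′)
        J∨T≡J∨J′ {T} T∈𝒯 rJ∪T =
          plane-unique-∋lines (𝒥₊-isLine (inj₁ J∈𝒥)) (𝒥₊-isLine (inj₁ J′∈𝒥)) J≢J′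
          (cl-isPlane {J ∪ T} rJ∪T) (join-isPlane (inj₁ J∈𝒥) (inj₁ J′∈𝒥) J≢J′)
          ⊆-cl-∪ˡ (subst (J′ ⊆_) (sym J∨T≡J′∨T) ⊆-cl-∪ˡ) ⊆-cl-∪ˡ ⊆-cl-∪ʳ
          where
            J∨T≡J′∨T : cl M (J ∪ T) ≡ cl M (J′ ∪ T)
            J∨T≡J′∨T = plane-unique-∋line+point (𝒯-isLine T∈𝒯) (𝒥-∉F∪L J∈𝒥 e∈J ∘ 𝒯⊆F∪L T∈𝒯)
              (cl-isPlane {J ∪ T} rJ∪T) (join-isPlane (inj₁ J′∈𝒥) (inj₂ T∈𝒯) (𝒥≢𝒯 J′∈𝒥 T∈𝒯))
              ⊆-cl-∪ʳ (⊆-cl-∪ˡ e∈J) ⊆-cl-∪ʳ (⊆-cl-∪ˡ e∈J′)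

    𝒥₊-meet⇒≡ : ∀ {J J′ e} → 𝒥₊ J → 𝒥₊ J′ → e ∈ J → e ∈ J′ → J ≡ J′
    𝒥₊-meet⇒≡ {J} {J′} (inj₁ J∈𝒥) (inj₁ J′∈𝒥) e∈J e∈J′ =
      decidable-stable (J ≟ₛ J′) λ J≢J′ → distinct-𝒥-disjoint J∈𝒥 J′∈𝒥 J≢J′ e∈J e∈J′
    𝒥₊-meet⇒≡ (inj₁ J∈𝒥) (inj₂ T∈𝒯) e∈J e∈T = ⊥-elim (𝒥-∉F∪L J∈𝒥 e∈J (𝒯⊆F∪L T∈𝒯 e∈T))
    𝒥₊-meet⇒≡ (inj₂ T∈𝒯) (inj₁ J∈𝒥) e∈T e∈J = ⊥-elim (𝒥-∉F∪L J∈𝒥 e∈J (𝒯⊆F∪L T∈𝒯 e∈T))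
    𝒥₊-meet⇒≡ (inj₂ T∈𝒯) (inj₂ T′∈𝒯) = 𝒯-meet⇒≡ T∈𝒯 T′∈𝒯

    𝒥₊-disjoint : ∀ J J′ → 𝒥₊ J → 𝒥₊ J′ → J ≢ J′ → J ∩ J′ ≡ ⊥
    𝒥₊-disjoint J J′ J∈𝒥₊ J′∈𝒥₊ J≢J′ = ∩≡⊥⁺ λ e∈J e∈J′ → J≢J′ (𝒥₊-meet⇒≡ J∈𝒥₊ J′∈𝒥₊ e∈J e∈J′)

    join-𝒯≡plane : ∀ {X J T e} → IsPlane X → 𝒯 T → T ⊆ X → 𝒥₊ J → J ≢ T → e ∈ J → e ∈ X →
                   cl M (J ∪ T) ≡ X
    join-𝒯≡plane planeX T∈𝒯 T⊆X J∈𝒥₊ J≢T e∈J e∈X =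
      plane-unique-∋line+point (𝒯-isLine T∈𝒯) (J≢T ∘ 𝒥₊-meet⇒≡ J∈𝒥₊ (inj₂ T∈𝒯) e∈J)
        (join-isPlane J∈𝒥₊ (inj₂ T∈𝒯) J≢T) planeX ⊆-cl-∪ʳ (⊆-cl-∪ˡ e∈J) T⊆X e∈X

    𝒥♯-⊇-meeting : ∀ {X J e} → 𝒥♯ X → 𝒥₊ J → e ∈ J → e ∈ X → J ⊆ X
    𝒥♯-⊇-meeting {X} {J} (flatX , rX , T , T∈𝒯 , T⊆X) J∈𝒥₊ e∈J e∈X = case J ≟ₛ T of λ where
      (yes refl) → T⊆X
      (no J≢T) → subst (J ⊆_) (join-𝒯≡plane (flatX , rX) T∈𝒯 T⊆X J∈𝒥₊ J≢T e∈J e∈X) ⊆-cl-∪ˡ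

    𝒥₊-⊂-or-disjoint : ∀ X J → 𝒥♯ X → 𝒥₊ J → J ⊂ X ⊎ J ∩ X ≡ ⊥
    𝒥₊-⊂-or-disjoint X J X∈𝒥♯@(flatX , rX , _) J∈𝒥₊ = case nonempty? (J ∩ X) of λ where
      (no J∩X-empty) → inj₂ (Empty-unique J∩X-empty)
      (yes (e , e∈J∩X)) → let (e∈J , e∈X) = x∈p∩q⁻ J X e∈J∩X in
        inj₁ (line⊂plane (𝒥₊-isLine J∈𝒥₊) (flatX , rX) (𝒥♯-⊇-meeting X∈𝒥♯ J∈𝒥₊ e∈J e∈X))

    𝒥♯⇒JoinOfPair : ∀ X → 𝒥♯ X → JoinOfPair X
    𝒥♯⇒JoinOfPair X (flatX , rX , _ , inj₁ refl , L⊆X) = joinOfPair-⊇L (flatX , rX) L⊆X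
    𝒥♯⇒JoinOfPair X (flatX , rX , _ , inj₂ (A , flatA , rA , L⊆A , refl) , T⊆X) =
      case X ≟ₛ A of λ where
        (yes refl) → joinOfPair-⊇L (flatA , rA) L⊆A
        (no X≢A) → case X ≟ₛ F of λ where
          (yes refl) → joinOfPair-F (flatA , rA) L⊆A
          (no X≢F) → joinOfPair-⊇trace (flatA , rA) L⊆A (flatX , rX) T⊆X X≢A X≢F

    JoinOfPair⇒𝒥♯ : ∀ X → JoinOfPair X → 𝒥♯ X
    JoinOfPair⇒𝒥♯ X (J , J′ , J∈𝒥₊ , J′∈𝒥₊ , J≢J′ , refl) = joins∈𝒥♯ J J′ J∈𝒥₊ J′∈𝒥₊ J≢J′

    line∉𝒥₊-joins-𝒯 : Loopless M → ∀ {X} → IsLine X → ¬ 𝒥₊ X → Σ (Subset m) λ T → 𝒯 T × r (X ∪ T) ≡ 3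
    line∉𝒥₊-joins-𝒯 loopless lineX X∉𝒥₊ =
      let (J , J′ , J∈𝒥₊ , J′∈𝒥₊ , J≢J′ , X⊆J∨J′) = line∉𝒥₊-⊆-join loopless lineX X∉𝒥₊
          (flatQ , rQ , T , T∈𝒯 , T⊆J∨J′) = joins∈𝒥♯ J J′ J∈𝒥₊ J′∈𝒥₊ J≢J′
      in T , T∈𝒯 ,
         r-lines-in-plane lineX (𝒯-isLine T∈𝒯) (∉𝒥₊⇒≢ X∉𝒥₊ (inj₂ T∈𝒯)) (flatQ , rQ) X⊆J∨J′ T⊆J∨J′

    -- Two distinct joins X ∨ T, X ∨ T′ would put X into 𝒥, once X misses F ∪ L; and a point x of
    -- X in F ∪ L lies on some Tx ∈ 𝒯 contained in both joins, which then coincide.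
    line∉𝒥₊-joins-unique : ∀ {X} → IsLine X → ¬ 𝒥₊ X → ∀ T T′ → 𝒯 T → 𝒯 T′ →
                           r (X ∪ T) ≡ 3 → r (X ∪ T′) ≡ 3 → cl M (X ∪ T) ≡ cl M (X ∪ T′)
    line∉𝒥₊-joins-unique {X} lineX@(flatX , rX) X∉𝒥₊ T T′ T∈𝒯 T′∈𝒯 rX∪T rX∪T′ =
      decidable-stable (cl M (X ∪ T) ≟ₛ cl M (X ∪ T′)) λ joins≢ →
        X∉𝒥₊ (inj₁ (flatX , rX , ∩≡⊥⁺ (X∌F∪L joins≢) , T , T′ , T∈𝒯 , T′∈𝒯 , rX∪T , rX∪T′ , joins≢))
      where
        X∌F∪L : cl M (X ∪ T) ≢ cl M (X ∪ T′) → ∀ {x} → x ∈ X → x ∉ F ∪ L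
        X∌F∪L joins≢ {x} x∈X x∈F∪L = let (Tx , Tx∈𝒯 , x∈Tx) = 𝒯-covers x∈F∪L in
          joins≢ (plane-unique-∋lines lineX (𝒯-isLine Tx∈𝒯) (∉𝒥₊⇒≢ X∉𝒥₊ (inj₂ Tx∈𝒯))
            (cl-isPlane rX∪T) (cl-isPlane rX∪T′)
            ⊆-cl-∪ˡ (𝒥♯-⊇-meeting (join-∈𝒥♯ T∈𝒯 rX∪T) (inj₂ Tx∈𝒯) x∈Tx (⊆-cl-∪ˡ x∈X))
            ⊆-cl-∪ˡ (𝒥♯-⊇-meeting (join-∈𝒥♯ T′∈𝒯 rX∪T′) (inj₂ Tx∈𝒯) x∈Tx (⊆-cl-∪ˡ x∈X)))

    line∉𝒥₊⇒ExactlyOne : Loopless M → ∀ X → IsFlat M X → r X ≡ 2 → ¬ 𝒥₊ X → ExactlyOne X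
    line∉𝒥₊⇒ExactlyOne loopless X flatX rX X∉𝒥₊ =
      line∉𝒥₊-joins-𝒯 loopless (flatX , rX) X∉𝒥₊ , line∉𝒥₊-joins-unique (flatX , rX) X∉𝒥₊

lemma4p3 : {m : ℕ} (M : Matroid m) →
    Loopless M → Hypermodular M → ¬ IsModular M →
    (F L : Subset m) →
    IsFlat M F → Matroid.r M F ≡ 3 →
    IsFlat M L → Matroid.r M L ≡ 2 →
    F ∩ L ≡ ⊥ →
    (∀ J J' → Setting.𝒥₊ M F L J → Setting.𝒥₊ M F L J' → J ≢ J' →
       Setting.𝒥♯ M F L (cl M (J ∪ J'))) →
    -- (1)
    (∀ X → (Setting.𝒥♯ M F L X → Setting.JoinOfPair M F L X) ×
           (Setting.JoinOfPair M F L X → Setting.𝒥♯ M F L X)) ×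
    -- (2)
    (∀ J J' → Setting.𝒥₊ M F L J → Setting.𝒥₊ M F L J' → J ≢ J' → J ∩ J' ≡ ⊥) ×
    -- (3) partition: nonempty blocks, pairwise disjoint (as in (2)), covering E
    ((∀ J → Setting.𝒥₊ M F L J → Nonempty J) ×
     (∀ J J' → Setting.𝒥₊ M F L J → Setting.𝒥₊ M F L J' → J ≢ J' → J ∩ J' ≡ ⊥) ×
     (∀ e → Σ (Subset m) λ J → Setting.𝒥₊ M F L J × e ∈ J)) ×
    -- (4)
    (∀ X → IsFlat M X → Matroid.r M X ≡ 2 → ¬ Setting.𝒥₊ M F L X →
       Setting.ExactlyOne M F L X) ×
    -- (5)
    (∀ X J → Setting.𝒥♯ M F L X → Setting.𝒥₊ M F L J → J ⊂ X ⊎ J ∩ X ≡ ⊥)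
lemma4p3 M loopless hyp _ F L flatF rF flatL rL F∩L≡⊥ joins∈𝒥♯ =
  (λ X → 𝒥♯⇒JoinOfPair X , JoinOfPair⇒𝒥♯ X) ,
  𝒥₊-disjoint ,
  (𝒥₊-nonempty , 𝒥₊-disjoint , 𝒥₊-covers) ,
  line∉𝒥₊⇒ExactlyOne loopless ,
  𝒥₊-⊂-or-disjoint
  where
    open Configuration M hyp F L (flatF , rF) (flatL , rL) F∩L≡⊥
    open JoinsIn𝒥♯ joins∈𝒥♯
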